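{- Let $d$ be a positive integer, $T$ a $d$-minimal triangle, and $g\in G$. Then $W(T) = W(g(T))$.
   Context: $\mathcal{L}_d = \frac{1}{d}\mathbb{Z}\times\frac{1}{d}\mathbb{Z}$. A triangle is $d$-minimal if its intersection with $\mathcal{L}_d$ consists exactly of its three vertices. $G = GL_2(\mathbb{Z}) \ltimes \mathbb{Z}^2$ acts on $\mathbb{R}^2$ by $x\mapsto Ux+v$ ($U\in GL_2(\mathbb{Z})$, $v\in\mathbb{Z}^2$). For an oriented segment $E_{p\to q}$ with $p=(w/d,x/d)$, $q=(y/d,z/d)$ ($w,x,y,z\in\mathbb{Z}$), $W(E_{p\to q}) = wz-xy \bmod d$. For a $d$-minimal triangle $T$ with vertices $p,q,r$ such that the counterclockwise orientation orients its edges $p\to q$, $q\to r$, $r\to p$, the weight $W(T)$ is the (unordered) multiset $\{W(E_{p\to q}), W(E_{q\to r}), W(E_{r\to p})\}$. -}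

module Defs where

open import Data.Nat as ℕ using (ℕ; NonZero)
open import Data.Integer using (ℤ; +_; _+_; _-_; _*_; -_; _<?_; _%ℕ_; 0ℤ; 1ℤ; -1ℤ)
open import Data.Product using (_×_; _,_; Σ; ∃; ∃-syntax)
open import Data.Sum using (_⊎_)
open import Data.List using (List; _∷_; [])
open import Data.Bool using (if_then_else_)
open import Relation.Nullary using (¬_; does)
open import Relation.Binary.PropositionalEquality using (_≡_)

-- A point of the lattice L_d = (1/d)ℤ × (1/d)ℤ is represented by its pair of
-- numerators (w , x) ∈ ℤ², standing for the point (w/d , x/d).
Pt : Set
Pt = ℤ × ℤ

_-ᵖ_ : Pt → Pt → Pt
(a , b) -ᵖ (c , e) = (a - c , b - e)

cross : Pt → Pt → ℤ
cross (a , b) (c , e) = a * e - b * c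

orient : Pt → Pt → Pt → ℤ
orient p q r = cross (q -ᵖ p) (r -ᵖ p)

-- Closed triangle with vertices p q r (in numerator coordinates): X is a convex
-- combination of p, q, r.  Since all points are rational, the weights may be
-- taken rational; clearing denominators, X lies in the triangle iff there are
-- a b c ∈ ℕ, not all zero, with (a+b+c)·X = a·p + b·q + c·r.
InTriangle : Pt → Pt → Pt → Pt → Set
InTriangle (p₁ , p₂) (q₁ , q₂) (r₁ , r₂) (x₁ , x₂) =
  ∃[ a ] ∃[ b ] ∃[ c ]
    ( ¬ (a ℕ.+ b ℕ.+ c ≡ 0)
    × ((+ (a ℕ.+ b ℕ.+ c)) * x₁ ≡ (+ a) * p₁ + (+ b) * q₁ + (+ c) * r₁)
    × ((+ (a ℕ.+ b ℕ.+ c)) * x₂ ≡ (+ a) * p₂ + (+ b) * q₂ + (+ c) * r₂) )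

dMinimal : Pt → Pt → Pt → Set
dMinimal p q r =
  ¬ (orient p q r ≡ 0ℤ)
  × (∀ (X : Pt) → InTriangle p q r X → X ≡ p ⊎ X ≡ q ⊎ X ≡ r)

Wedge : (d : ℕ) .{{_ : NonZero d}} → Pt → Pt → ℕ
Wedge d (w , x) (y , z) = (w * z - x * y) %ℕ d

-- Weight of the triangle with vertices p q r, as a list (a multiset, compared
-- up to permutation), computed along the counterclockwise orientation.
WTri : (d : ℕ) .{{_ : NonZero d}} → Pt → Pt → Pt → List ℕ
WTri d p q r =
  if does (0ℤ <? orient p q r)
  then Wedge d p q ∷ Wedge d q r ∷ Wedge d r p ∷ []
  else Wedge d p r ∷ Wedge d r q ∷ Wedge d q p ∷ []

-- Elements of G = GL₂(ℤ) ⋉ ℤ²: x ↦ U x + v with U = [[a , b] , [c , e]],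
-- det U = ±1, v ∈ ℤ².
record GElt : Set where
  field
    a b c e : ℤ
    det± : (a * e - b * c ≡ 1ℤ) ⊎ (a * e - b * c ≡ -1ℤ)
    v₁ v₂ : ℤ

-- Action of g on a point of L_d, in numerator coordinates:
-- (w/d , x/d) ↦ U (w/d , x/d) + v = ((a w + b x + d v₁)/d , (c w + e x + d v₂)/d).
act : (d : ℕ) → GElt → Pt → Pt
act d g (w , x) = (a * w + b * x + (+ d) * v₁ , c * w + e * x + (+ d) * v₂)
  where open GElt g

-- An element g : x ↦ U x + v of G scales every cross product by det U = ±1,
-- and, since v is integral, the translation only changes the cross product of
-- two points of L_d by a multiple of d.  Hence g preserves every edge weight when
-- det U = 1; when det U = -1 it reverses both the orientation of the triangle
-- and every edge, so the counterclockwise list of edge weights is read backwards.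
module Submission where

open import Defs
open import Data.Nat using (ℕ; NonZero)
open import Data.List.Relation.Binary.Permutation.Propositional using (_↭_)

open import Data.Bool using (Bool; true; false; not; if_then_else_)
open import Data.Integer
  using (ℤ; +_; +[1+_]; -[1+_]; _+_; _-_; _*_; -_; _<?_; _%ℕ_; _/ℕ_; 0ℤ; 1ℤ; -1ℤ; ∣_∣)
open import Data.Integer.Properties
  using (+-injective; i-j≡0⇒i≡j; ∣i∣≡0⇒i≡0; [+m]-[+n]≡m⊖n; ∣m⊝n∣≤m⊔n; abs-*; +-assoc; *-comm; *-distribʳ-+; *-identityˡ; -1*i≡-i)
open import Data.Integer.DivMod using (a≡a%ℕn+[a/ℕn]*n; n%ℕd<d)
open import Data.Integer.Tactic.RingSolver using (solve)
open import Data.List using (List; _∷_; []; reverse)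
open import Data.List.Relation.Binary.Permutation.Propositional using (↭-reflexive; ↭-trans; ↭-sym)
open import Data.List.Relation.Binary.Permutation.Propositional.Properties using (↭-reverse)
import Data.Nat as ℕ
open import Data.Nat.Divisibility using (_∣_; divides; ∣⇒≤)
open import Data.Nat.Properties using (<⇒≱; ⊔-pres-<m; ≤-<-trans)
open import Data.Product using (_,_)
open import Data.Sum using (inj₁; inj₂)
open import Function using (flip; _∋_)
open import Relation.Nullary using (¬_; does; contradiction)
open import Relation.Binary.PropositionalEquality using (_≡_; refl; sym; trans; cong; cong₂; module ≡-Reasoning)

open ≡-Reasoning

n∣m∧m<n⇒m≡0 : ∀ {m n} → n ∣ m → m ℕ.< n → m ≡ 0
n∣m∧m<n⇒m≡0 {ℕ.zero}  _   _   = refl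
n∣m∧m<n⇒m≡0 {ℕ.suc m} n∣m m<n = contradiction (∣⇒≤ n∣m) (<⇒≱ m<n)

i+a*c≡j+b*c⇒i-j≡[b-a]*c : ∀ i j a b c → i + a * c ≡ j + b * c → i - j ≡ (b - a) * c
i+a*c≡j+b*c⇒i-j≡[b-a]*c i j a b c eq = begin
  i - j                     ≡⟨ solve (i ∷ j ∷ a ∷ c ∷ []) ⟩
  (i + a * c) - (j + a * c) ≡⟨ cong (_- (j + a * c)) eq ⟩
  (j + b * c) - (j + a * c) ≡⟨ solve (j ∷ a ∷ b ∷ c ∷ []) ⟩
  (b - a) * c               ∎

remainder-unique : ∀ d {r₁ r₂} (q₁ q₂ : ℤ) → r₁ ℕ.< d → r₂ ℕ.< d →
                   + r₁ + q₁ * + d ≡ + r₂ + q₂ * + d → r₁ ≡ r₂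
remainder-unique d {r₁} {r₂} q₁ q₂ r₁<d r₂<d eq =
  +-injective (i-j≡0⇒i≡j (+ r₁) (+ r₂) (∣i∣≡0⇒i≡0 (n∣m∧m<n⇒m≡0 d∣∣r₁-r₂∣ ∣r₁-r₂∣<d)))
  where
  d∣∣r₁-r₂∣ : d ∣ ∣ + r₁ - + r₂ ∣
  d∣∣r₁-r₂∣ = divides ∣ q₂ - q₁ ∣
    (trans (cong ∣_∣ (i+a*c≡j+b*c⇒i-j≡[b-a]*c (+ r₁) (+ r₂) q₁ q₂ (+ d) eq)) (abs-* (q₂ - q₁) (+ d)))
  ∣r₁-r₂∣<d : ∣ + r₁ - + r₂ ∣ ℕ.< d
  ∣r₁-r₂∣<d rewrite [+m]-[+n]≡m⊖n r₁ r₂ = ≤-<-trans (∣m⊝n∣≤m⊔n r₁ r₂) (⊔-pres-<m r₁<d r₂<d)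

%ℕ-+-multiple : ∀ d .{{_ : NonZero d}} i k → (i + + d * k) %ℕ d ≡ i %ℕ d
%ℕ-+-multiple d i k =
  remainder-unique d ((i + + d * k) /ℕ d) (i /ℕ d + k) (n%ℕd<d (i + + d * k) d) (n%ℕd<d i d) (begin
    + ((i + + d * k) %ℕ d) + ((i + + d * k) /ℕ d) * + d ≡⟨ sym (a≡a%ℕn+[a/ℕn]*n (i + + d * k) d) ⟩
    i + + d * k                                         ≡⟨ cong (_+ + d * k) (a≡a%ℕn+[a/ℕn]*n i d) ⟩
    + r + q * + d + + d * k                             ≡⟨ +-assoc (+ r) (q * + d) (+ d * k) ⟩
    + r + (q * + d + + d * k)                           ≡⟨ cong (λ x → + r + (q * + d + x)) (*-comm (+ d) k) ⟩
    + r + (q * + d + k * + d)                           ≡⟨ cong (_+_ (+ r)) (*-distribʳ-+ (+ d) q k) ⟨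
    + r + (q + k) * + d                                 ∎)
  where
  r : ℕ
  r = i %ℕ d
  q : ℤ
  q = i /ℕ d

infixl 6 _+ᵖ_
infixr 7 _·ᵖ_

_+ᵖ_ : Pt → Pt → Pt
(a , b) +ᵖ (c , e) = (a + c , b + e)

_·ᵖ_ : ℤ → Pt → Pt
k ·ᵖ (a , b) = (k * a , k * b)

cross-swap : ∀ u w → cross w u ≡ - cross u w
cross-swap (a , b) (c , e) =
  (c * b - e * a ≡ - (a * e - b * c)) ∋ solve (a ∷ b ∷ c ∷ e ∷ [])

+ᵖ-−ᵖ-cancelʳ : ∀ u w t → (u +ᵖ t) -ᵖ (w +ᵖ t) ≡ u -ᵖ w
+ᵖ-−ᵖ-cancelʳ (a , b) (c , e) (t₁ , t₂) =
  cong₂ _,_ ((a + t₁ - (c + t₁) ≡ a - c) ∋ solve (a ∷ c ∷ t₁ ∷ []))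
            ((b + t₂ - (e + t₂) ≡ b - e) ∋ solve (b ∷ e ∷ t₂ ∷ []))

cross-+ᵖ-·ᵖ : ∀ k u w t → cross (u +ᵖ k ·ᵖ t) (w +ᵖ k ·ᵖ t) ≡ cross u w + k * (cross u t + cross t w)
cross-+ᵖ-·ᵖ k (a , b) (c , e) (t₁ , t₂) =
  ((a + k * t₁) * (e + k * t₂) - (b + k * t₂) * (c + k * t₁)
     ≡ a * e - b * c + k * ((a * t₂ - b * t₁) + (t₁ * e - t₂ * c)))
  ∋ solve (k ∷ a ∷ b ∷ c ∷ e ∷ t₁ ∷ t₂ ∷ [])

module _ (g : GElt) where
  open GElt g

  det : ℤ
  det = a * e - b * c

  linear : Pt → Pt
  linear (w , x) = (a * w + b * x , c * w + e * x)

  translation : Pt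
  translation = (v₁ , v₂)

  linear-−ᵖ : ∀ u w → linear u -ᵖ linear w ≡ linear (u -ᵖ w)
  linear-−ᵖ (w , x) (y , z) = cong₂ _,_ (row-difference a b) (row-difference c e)
    where
    row-difference : ∀ s t → s * w + t * x - (s * y + t * z) ≡ s * (w - y) + t * (x - z)
    row-difference s t = solve (s ∷ t ∷ w ∷ x ∷ y ∷ z ∷ [])

  cross-linear : ∀ u w → cross (linear u) (linear w) ≡ det * cross u w
  cross-linear (w , x) (y , z) = det-multiplicative a b c e
    where
    det-multiplicative : ∀ a b c e →
      (a * w + b * x) * (c * y + e * z) - (c * w + e * x) * (a * y + b * z)
        ≡ (a * e - b * c) * (w * z - x * y)
    det-multiplicative a b c e = solve (a ∷ b ∷ c ∷ e ∷ w ∷ x ∷ y ∷ z ∷ [])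

act-−ᵖ : ∀ d g u w → act d g u -ᵖ act d g w ≡ linear g (u -ᵖ w)
act-−ᵖ d g u w =
  trans (+ᵖ-−ᵖ-cancelʳ (linear g u) (linear g w) (+ d ·ᵖ translation g)) (linear-−ᵖ g u w)

orient-act : ∀ d g p q r → orient (act d g p) (act d g q) (act d g r) ≡ det g * orient p q r
orient-act d g p q r =
  trans (cong₂ cross (act-−ᵖ d g q p) (act-−ᵖ d g r p)) (cross-linear g (q -ᵖ p) (r -ᵖ p))

Wedge-act : ∀ d .{{_ : NonZero d}} g u w → Wedge d (act d g u) (act d g w) ≡ (det g * cross u w) %ℕ d
Wedge-act d g u w = begin
  cross (act d g u) (act d g w) %ℕ d                    ≡⟨ cong (_%ℕ d) (cross-+ᵖ-·ᵖ (+ d) gu gw v) ⟩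
  (cross gu gw + + d * (cross gu v + cross v gw)) %ℕ d  ≡⟨ %ℕ-+-multiple d (cross gu gw) (cross gu v + cross v gw) ⟩
  cross gu gw %ℕ d                                      ≡⟨ cong (_%ℕ d) (cross-linear g u w) ⟩
  (det g * cross u w) %ℕ d                              ∎
  where
  gu gw v : Pt
  gu = linear g u
  gw = linear g w
  v  = translation g

module _ (d : ℕ) .{{_ : NonZero d}} (g : GElt) where

  Wedge-act-det≡1 : det g ≡ 1ℤ → ∀ u w → Wedge d (act d g u) (act d g w) ≡ Wedge d u w
  Wedge-act-det≡1 det≡1 u w = begin
    Wedge d (act d g u) (act d g w) ≡⟨ Wedge-act d g u w ⟩
    (det g * cross u w) %ℕ d        ≡⟨ cong (λ k → (k * cross u w) %ℕ d) det≡1 ⟩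
    (1ℤ * cross u w) %ℕ d           ≡⟨ cong (_%ℕ d) (*-identityˡ (cross u w)) ⟩
    cross u w %ℕ d                  ∎

  Wedge-act-det≡-1 : det g ≡ -1ℤ → ∀ u w → Wedge d (act d g u) (act d g w) ≡ Wedge d w u
  Wedge-act-det≡-1 det≡-1 u w = begin
    Wedge d (act d g u) (act d g w) ≡⟨ Wedge-act d g u w ⟩
    (det g * cross u w) %ℕ d        ≡⟨ cong (λ k → (k * cross u w) %ℕ d) det≡-1 ⟩
    (-1ℤ * cross u w) %ℕ d          ≡⟨ cong (_%ℕ d) (-1*i≡-i (cross u w)) ⟩
    (- cross u w) %ℕ d              ≡⟨ cong (_%ℕ d) (cross-swap u w) ⟨
    cross w u %ℕ d                  ∎

counterclockwise : Pt → Pt → Pt → Bool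
counterclockwise p q r = does (0ℤ <? orient p q r)

does-0<?-neg : ∀ {i} → ¬ (i ≡ 0ℤ) → does (0ℤ <? - i) ≡ not (does (0ℤ <? i))
does-0<?-neg {+ ℕ.zero} i≢0 = contradiction refl i≢0
does-0<?-neg {+[1+ _ ]} _   = refl
does-0<?-neg { -[1+ _ ]} _  = refl

module _ (d : ℕ) (g : GElt) (p q r : Pt) where

  counterclockwise-act-det≡1 : det g ≡ 1ℤ →
    counterclockwise (act d g p) (act d g q) (act d g r) ≡ counterclockwise p q r
  counterclockwise-act-det≡1 det≡1 = cong (λ i → does (0ℤ <? i)) (begin
    orient (act d g p) (act d g q) (act d g r) ≡⟨ orient-act d g p q r ⟩
    det g * orient p q r                       ≡⟨ cong (_* orient p q r) det≡1 ⟩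
    1ℤ * orient p q r                          ≡⟨ *-identityˡ (orient p q r) ⟩
    orient p q r                               ∎)

  counterclockwise-act-det≡-1 : det g ≡ -1ℤ → ¬ (orient p q r ≡ 0ℤ) →
    counterclockwise (act d g p) (act d g q) (act d g r) ≡ not (counterclockwise p q r)
  counterclockwise-act-det≡-1 det≡-1 nondegenerate =
    trans (cong (λ i → does (0ℤ <? i)) (begin
      orient (act d g p) (act d g q) (act d g r) ≡⟨ orient-act d g p q r ⟩
      det g * orient p q r                       ≡⟨ cong (_* orient p q r) det≡-1 ⟩
      -1ℤ * orient p q r                         ≡⟨ -1*i≡-i (orient p q r) ⟩
      - orient p q r                             ∎))
      (does-0<?-neg nondegenerate)

-- WTri d p q r unfolds to edgeWeights (counterclockwise p q r) (Wedge d) p q r.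
edgeWeights : {A : Set} → Bool → (Pt → Pt → A) → Pt → Pt → Pt → List A
edgeWeights s w p q r = if s then w p q ∷ w q r ∷ w r p ∷ [] else w p r ∷ w r q ∷ w q p ∷ []

edgeWeights-cong : ∀ {A : Set} {s s′ : Bool} {w w′ : Pt → Pt → A} → s ≡ s′ → (∀ x y → w x y ≡ w′ x y) →
                   ∀ p q r → edgeWeights s w p q r ≡ edgeWeights s′ w′ p q r
edgeWeights-cong {s = true}  refl w≡w′ p q r =
  cong₂ _∷_ (w≡w′ p q) (cong₂ _∷_ (w≡w′ q r) (cong (_∷ []) (w≡w′ r p)))
edgeWeights-cong {s = false} refl w≡w′ p q r =
  cong₂ _∷_ (w≡w′ p r) (cong₂ _∷_ (w≡w′ r q) (cong (_∷ []) (w≡w′ q p)))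

edgeWeights-not-flip : ∀ {A : Set} s (w : Pt → Pt → A) p q r →
                       edgeWeights (not s) (flip w) p q r ≡ reverse (edgeWeights s w p q r)
edgeWeights-not-flip true  w p q r = refl
edgeWeights-not-flip false w p q r = refl

mainTheorem7 : (d : ℕ) .{{_ : NonZero d}} (p q r : Pt) (g : GElt) →
    dMinimal p q r →
    WTri d p q r ↭ WTri d (act d g p) (act d g q) (act d g r)
mainTheorem7 d p q r g (nondegenerate , _) with GElt.det± g
... | inj₁ det≡1 = ↭-reflexive
  (edgeWeights-cong (sym (counterclockwise-act-det≡1 d g p q r det≡1))
                    (λ u w → sym (Wedge-act-det≡1 d g det≡1 u w)) p q r)
... | inj₂ det≡-1 = ↭-trans (↭-sym (↭-reverse (WTri d p q r))) (↭-reflexive (begin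
  reverse (WTri d p q r)                         ≡⟨ edgeWeights-not-flip ccw (Wedge d) p q r ⟨
  edgeWeights (not ccw) (flip (Wedge d)) p q r   ≡⟨ edgeWeights-cong
      (sym (counterclockwise-act-det≡-1 d g p q r det≡-1 nondegenerate))
      (λ u w → sym (Wedge-act-det≡-1 d g det≡-1 u w)) p q r ⟩
  WTri d (act d g p) (act d g q) (act d g r)     ∎))
  where
  ccw : Bool
  ccw = counterclockwise p q r
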